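{- For every theory $T$ and every formula $\varphi$ (in either the basic or the extended case), if $T\vdash 0\le\varphi$ then $T\vDash 0\le\varphi$.
   Context: $\mathbb R$-valued propositional logic. A language $L$ is a set of proposition letters; basic and extended cases. Formulas: least set containing proposition letters and the constant $0$ (and in the extended case the constant $1$), closed under binary $+$, $\wedge$ and unary $q$ for each $q\in\mathbb Q$. Abbreviation: $-\varphi$ is $(-1)\varphi$. A structure is $M:L\to\mathbb R$ (values in $[-1,1]$ in the extended case), extended by $0^M=0$, $1^M=1$, $P^M=M(P)$, $(\psi+\xi)^M=\psi^M+\xi^M$, $(\psi\wedge\xi)^M=\min\{\psi^M,\xi^M\}$, $(q\psi)^M=q\psi^M$. An inequality is an ordered pair of formulas $\varphi\le\psi$; $\varphi=\psi$ abbreviates both inequalities. A theory is a set of inequalities; $T\vDash\varphi\le\psi$ means every structure $M$ satisfying $\alpha^M\le\beta^M$ for all $\alpha\le\beta$ in $T$ satisfies $\varphi^M\le\psi^M$. $\mathbb Q^+$ is the set of nonnegative rationals. Logical axioms (all formulas, all $r,s\in\mathbb Q$): $\varphi+\psi=\psi+\varphi$; $(\varphi+\psi)+\xi=\psi+(\varphi+\xi)$; $\varphi+0=\varphi$; $1\varphi=\varphi$; $0\varphi\le0$; $r\varphi+s\varphi=(s+r)\varphi$; $r\varphi+r\psi=r(\varphi+\psi)$; $r(s\varphi)=(rs)\varphi$; $\varphi\wedge\varphi=\varphi$; $\varphi\wedge\psi=\psi\wedge\varphi$; $(\varphi\wedge\psi)\wedge\xi=\varphi\wedge(\psi\wedge\xi)$;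 $(\varphi+\xi)\wedge(\psi+\xi)=\varphi\wedge\psi+\xi$; $r(\varphi\wedge\psi)=r\varphi\wedge r\psi$ for $r\in\mathbb Q^+$; $\varphi\wedge\psi\le\psi$; extended case only: $-1\le P\le1$ for each proposition letter $P$. Rules: (r1) from $\varphi\le\xi$, $\xi\le\psi$ infer $\varphi\le\psi$; (r2) from $\varphi\le\psi$ infer $r\varphi+\xi\le r\psi+\xi$ ($r\in\mathbb Q^+$, any $\xi$); (r3) from $\varphi\le\psi$ infer $\varphi\wedge0\le\psi\wedge0$. $T\vdash$ denotes Hilbert-style derivability from $T$ and the axioms by r1–r3. -}

module Defs where

open import Level using (0ℓ)
open import Data.Product using (Σ; _×_; proj₁)
open import Data.Sum using (_⊎_; inj₁; inj₂)
open import Data.Unit using (⊤)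
open import Relation.Nullary using (¬_)
open import Relation.Binary.PropositionalEquality using (_≡_)
open import Relation.Binary.Structures using (IsTotalOrder)
open import Algebra.Structures using (IsCommutativeRing)
open import Data.Rational as ℚ using (ℚ; 0ℚ; 1ℚ)

-- The real numbers, axiomatised as a complete ordered field
-- (unique up to isomorphism), together with the embedding of ℚ
-- (a unital ring homomorphism, hence the canonical one).

record RealNumbers : Set₁ where
  infixl 6 _+_
  infixl 7 _*_
  infix 4 _≤_
  field
    ℝ : Set
    _+_ _*_ : ℝ → ℝ → ℝ
    -_ : ℝ → ℝ
    0r 1r : ℝ
    _≤_ : ℝ → ℝ → Set
    isCommutativeRing : IsCommutativeRing _≡_ _+_ _*_ -_ 0r 1r
    0≢1 : ¬ (0r ≡ 1r)
    inverse : ∀ x → ¬ (x ≡ 0r) → Σ ℝ (λ y → x * y ≡ 1r)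
    isTotalOrder : IsTotalOrder _≡_ _≤_
    +-mono-≤ : ∀ {x y} z → x ≤ y → x + z ≤ y + z
    *-nonneg : ∀ {x y} → 0r ≤ x → 0r ≤ y → 0r ≤ x * y
    complete : (S : ℝ → Set) → Σ ℝ S → Σ ℝ (λ b → ∀ x → S x → x ≤ b) →
               Σ ℝ (λ s → (∀ x → S x → x ≤ s) ×
                          (∀ b → (∀ x → S x → x ≤ b) → s ≤ b))
    fromℚ : ℚ → ℝ
    fromℚ-+ : ∀ p q → fromℚ (p ℚ.+ q) ≡ fromℚ p + fromℚ q
    fromℚ-* : ∀ p q → fromℚ (p ℚ.* q) ≡ fromℚ p * fromℚ q
    fromℚ-1 : fromℚ 1ℚ ≡ 1r

  open IsTotalOrder isTotalOrder public using (total)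

  min : ℝ → ℝ → ℝ
  min x y with total x y
  ... | inj₁ _ = x
  ... | inj₂ _ = y

data Case : Set where
  basic extended : Case

infixl 6 _⊕_
infixl 7 _⊓_
infix 8 _·_

data Formula (L : Set) : Case → Set where
  var  : ∀ {c} → L → Formula L c
  𝟘    : ∀ {c} → Formula L c
  𝟙    : Formula L extended
  _⊕_  : ∀ {c} → Formula L c → Formula L c → Formula L c
  _⊓_  : ∀ {c} → Formula L c → Formula L c → Formula L c
  _·_  : ∀ {c} → ℚ → Formula L c → Formula L c

neg : ∀ {L c} → Formula L c → Formula L c
neg φ = (ℚ.- 1ℚ) · φ

infix 4 _≼_
record Ineq (L : Set) (c : Case) : Set where
  constructor _≼_
  field
    lhs rhs : Formula L c

Theory : Set → Case → Set₁
Theory L c = Ineq L c → Set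

module _ (R : RealNumbers) where
  open RealNumbers R

  Admissible : (L : Set) → Case → (L → ℝ) → Set
  Admissible L basic    M = ⊤
  Admissible L extended M = ∀ P → (- 1r ≤ M P) × (M P ≤ 1r)

  Structure : Set → Case → Set
  Structure L c = Σ (L → ℝ) (Admissible L c)

  ⟦_⟧ : ∀ {L c} → Formula L c → (L → ℝ) → ℝ
  ⟦ var P ⟧ M = M P
  ⟦ 𝟘 ⟧ M = 0r
  ⟦ 𝟙 ⟧ M = 1r
  ⟦ φ ⊕ ψ ⟧ M = ⟦ φ ⟧ M + ⟦ ψ ⟧ M
  ⟦ φ ⊓ ψ ⟧ M = min (⟦ φ ⟧ M) (⟦ ψ ⟧ M)
  ⟦ q · φ ⟧ M = fromℚ q * ⟦ φ ⟧ M

  Holds : ∀ {L c} → (L → ℝ) → Ineq L c → Set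
  Holds M (φ ≼ ψ) = ⟦ φ ⟧ M ≤ ⟦ ψ ⟧ M

infix 3 _⊨_
_⊨_ : ∀ {L c} → Theory L c → Ineq L c → Set₁
_⊨_ {L} {c} T i = (R : RealNumbers) (M : Structure R L c) →
  (∀ j → T j → Holds R (proj₁ M) j) → Holds R (proj₁ M) i

data AxEq {L : Set} {c : Case} : Formula L c → Formula L c → Set where
  ⊕-comm   : ∀ φ ψ → AxEq (φ ⊕ ψ) (ψ ⊕ φ)
  ⊕-assoc  : ∀ φ ψ ξ → AxEq ((φ ⊕ ψ) ⊕ ξ) (ψ ⊕ (φ ⊕ ξ))
  ⊕-id     : ∀ φ → AxEq (φ ⊕ 𝟘) φ
  one-·    : ∀ φ → AxEq (1ℚ · φ) φ
  ·-distˡ  : ∀ r s φ → AxEq ((r · φ) ⊕ (s · φ)) ((s ℚ.+ r) · φ)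
  ·-distʳ  : ∀ r φ ψ → AxEq ((r · φ) ⊕ (r · ψ)) (r · (φ ⊕ ψ))
  ·-assoc  : ∀ r s φ → AxEq (r · (s · φ)) ((r ℚ.* s) · φ)
  ⊓-idem   : ∀ φ → AxEq (φ ⊓ φ) φ
  ⊓-comm   : ∀ φ ψ → AxEq (φ ⊓ ψ) (ψ ⊓ φ)
  ⊓-assoc  : ∀ φ ψ ξ → AxEq ((φ ⊓ ψ) ⊓ ξ) (φ ⊓ (ψ ⊓ ξ))
  ⊓-⊕      : ∀ φ ψ ξ → AxEq ((φ ⊕ ξ) ⊓ (ψ ⊕ ξ)) ((φ ⊓ ψ) ⊕ ξ)
  ·-⊓      : ∀ r φ ψ → 0ℚ ℚ.≤ r → AxEq (r · (φ ⊓ ψ)) ((r · φ) ⊓ (r · ψ))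

data Axiom {L : Set} : {c : Case} → Ineq L c → Set where
  eqˡ    : ∀ {c} {φ ψ : Formula L c} → AxEq φ ψ → Axiom (φ ≼ ψ)
  eqʳ    : ∀ {c} {φ ψ : Formula L c} → AxEq φ ψ → Axiom (ψ ≼ φ)
  zero-· : ∀ {c} (φ : Formula L c) → Axiom ((0ℚ · φ) ≼ 𝟘)
  ⊓-≤    : ∀ {c} (φ ψ : Formula L c) → Axiom ((φ ⊓ ψ) ≼ ψ)
  bound₁ : (P : L) → Axiom {c = extended} (neg 𝟙 ≼ var P)
  bound₂ : (P : L) → Axiom {c = extended} (var P ≼ 𝟙)

infix 3 _⊢_
data _⊢_ {L : Set} {c : Case} (T : Theory L c) : Ineq L c → Set where
  hyp : ∀ {i} → T i → T ⊢ i
  ax  : ∀ {i} → Axiom i → T ⊢ i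
  r1  : ∀ {φ ξ ψ} → T ⊢ φ ≼ ξ → T ⊢ ξ ≼ ψ → T ⊢ φ ≼ ψ
  r2  : ∀ {φ ψ} (r : ℚ) (ξ : Formula L c) → 0ℚ ℚ.≤ r →
        T ⊢ φ ≼ ψ → T ⊢ (r · φ) ⊕ ξ ≼ (r · ψ) ⊕ ξ
  r3  : ∀ {φ ψ} → T ⊢ φ ≼ ψ → T ⊢ φ ⊓ 𝟘 ≼ ψ ⊓ 𝟘

module Submission where

-- The theorem is the instance 𝟘 ≼ φ of soundness: every inequality derivable
-- from T holds in every structure satisfying T.  Soundness is proved by
-- induction on derivations, so the work lies in checking, for an arbitrary
-- model R of the reals (a complete ordered field with a ring embedding fromℚ
-- of ℚ), that every axiom is valid and every rule preserves validity.  For r = n/(d+1) ≥ 0 we have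
-- r·(d+1) = n in ℚ; the images of n and d+1 in R are nonnegative and d+1 is
-- moreover nonzero, hence invertible with nonnegative inverse, so that
-- fromℚ r = fromℚ n · (fromℚ (d+1))⁻¹ ≥ 0.

open import Defs
open import Level using (0ℓ)
open import Data.Product using (_,_; proj₁; proj₂)
open import Data.Sum using (inj₁; inj₂)
open import Data.Nat as ℕ using (ℕ; zero; suc)
import Data.Nat.Properties as ℕP
open import Data.Nat.Coprimality using (Coprime)
open import Data.Integer as ℤ using (ℤ; -[1+_])
import Data.Integer.Properties as ℤP
open import Data.Integer.Tactic.RingSolver using (solve-∀)
open import Data.Rational as ℚ using (ℚ; 0ℚ; 1ℚ; mkℚ; toℚᵘ)
import Data.Rational.Properties as ℚP
open import Data.Rational.Unnormalised as ℚᵘ using (mkℚᵘ; *≡*)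
import Data.Rational.Unnormalised.Properties as ℚᵘP
open import Relation.Nullary using (¬_)
open import Relation.Binary.PropositionalEquality
open import Relation.Binary.Structures using (IsTotalOrder)
open import Relation.Binary.Bundles using (TotalPreorder)
open import Algebra.Structures using (IsCommutativeRing)
open import Algebra.Bundles using (Ring)
open import Algebra.Construct.NaturalChoice.Base using (MinOperator)
import Algebra.Construct.NaturalChoice.MinOp as MinOp
import Algebra.Properties.Ring as RingProperties

-- The natural number k as the rational 1 + (1 + ⋯ + (1 + 0)).  This unfolding
-- lets its image under the additive map fromℚ be computed by induction.
numeral : ℕ → ℚ
numeral zero    = 0ℚ
numeral (suc k) = 1ℚ ℚ.+ numeral k

-- Cross-multiplied form of 1/1 + k/1 = (1 + k)/1.
one-plus-cross : ∀ (k : ℤ) → (ℤ.+ 1 ℤ.* ℤ.+ 1 ℤ.+ k ℤ.* ℤ.+ 1) ℤ.* ℤ.+ 1 ≡ (ℤ.+ 1 ℤ.+ k) ℤ.* ℤ.+ 1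
one-plus-cross = solve-∀

numeral-toℚᵘ : ∀ k → toℚᵘ (numeral k) ℚᵘ.≃ mkℚᵘ (ℤ.+ k) 0
numeral-toℚᵘ zero    = ℚᵘP.≃-refl
numeral-toℚᵘ (suc k) = begin
  toℚᵘ (1ℚ ℚ.+ numeral k)          ≈⟨ ℚP.toℚᵘ-homo-+ 1ℚ (numeral k) ⟩
  toℚᵘ 1ℚ ℚᵘ.+ toℚᵘ (numeral k)    ≈⟨ ℚᵘP.+-congʳ (toℚᵘ 1ℚ) (numeral-toℚᵘ k) ⟩
  toℚᵘ 1ℚ ℚᵘ.+ mkℚᵘ (ℤ.+ k) 0      ≈⟨ *≡* (one-plus-cross (ℤ.+ k)) ⟩
  mkℚᵘ (ℤ.+ suc k) 0               ∎
  where open ℚᵘP.≃-Reasoning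

clear-denominator : ∀ n d .(c : Coprime n (suc d)) →
                    mkℚ (ℤ.+ n) d c ℚ.* numeral (suc d) ≡ numeral n
clear-denominator n d c = ℚP.toℚᵘ-injective (begin
  toℚᵘ (r ℚ.* numeral (suc d))                ≈⟨ ℚP.toℚᵘ-homo-* r (numeral (suc d)) ⟩
  toℚᵘ r ℚᵘ.* toℚᵘ (numeral (suc d))          ≈⟨ ℚᵘP.*-congˡ {toℚᵘ r} (numeral-toℚᵘ (suc d)) ⟩
  mkℚᵘ (ℤ.+ n) d ℚᵘ.* mkℚᵘ (ℤ.+ suc d) 0      ≈⟨ *≡* cross-multiplied ⟩
  mkℚᵘ (ℤ.+ n) 0                              ≈⟨ ℚᵘP.≃-sym (numeral-toℚᵘ n) ⟩
  toℚᵘ (numeral n)                            ∎)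
  where
  open ℚᵘP.≃-Reasoning
  r : ℚ
  r = mkℚ (ℤ.+ n) d c
  cross-multiplied : (ℤ.+ n ℤ.* ℤ.+ suc d) ℤ.* ℤ.+ 1 ≡ ℤ.+ n ℤ.* ℤ.+ suc (d ℕ.* 1)
  cross-multiplied = trans (ℤP.*-identityʳ _) (cong (λ m → ℤ.+ n ℤ.* ℤ.+ suc m) (sym (ℕP.*-identityʳ d)))

module OrderedField (R : RealNumbers) where
  open RealNumbers R
  open IsCommutativeRing isCommutativeRing
    using (+-assoc; +-comm; +-identityˡ; +-identityʳ; -‿inverseˡ; -‿inverseʳ;
           *-assoc; *-identityˡ; *-identityʳ; distribˡ; isRing)
  open IsTotalOrder isTotalOrder using (antisym)
    renaming (trans to ≤-trans; reflexive to ≤-reflexive)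

  ℝ-ring : Ring 0ℓ 0ℓ
  ℝ-ring = record { isRing = isRing }

  open RingProperties ℝ-ring
    using (+-identityˡ-unique; +-inverseˡ-unique; -‿distribˡ-*; -‿distribʳ-*; -‿involutive)
  open ≡-Reasoning

  ≤⇒0≤diff : ∀ {x y} → x ≤ y → 0r ≤ y + - x
  ≤⇒0≤diff {x} {y} x≤y = subst (_≤ y + - x) (-‿inverseʳ x) (+-mono-≤ (- x) x≤y)

  0≤diff⇒≤ : ∀ {x y} → 0r ≤ y + - x → x ≤ y
  0≤diff⇒≤ {x} {y} 0≤y-x = subst₂ _≤_ (+-identityˡ x) y-x+x≡y (+-mono-≤ x 0≤y-x)
    where
    y-x+x≡y : y + - x + x ≡ y
    y-x+x≡y = begin
      y + - x + x    ≡⟨ +-assoc y (- x) x ⟩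
      y + (- x + x)  ≡⟨ cong (y +_) (-‿inverseˡ x) ⟩
      y + 0r         ≡⟨ +-identityʳ y ⟩
      y              ∎

  ≤0⇒0≤- : ∀ {x} → x ≤ 0r → 0r ≤ - x
  ≤0⇒0≤- {x} x≤0 = subst (0r ≤_) (+-identityˡ (- x)) (≤⇒0≤diff x≤0)

  +-nonneg : ∀ {x y} → 0r ≤ x → 0r ≤ y → 0r ≤ x + y
  +-nonneg {x} {y} 0≤x 0≤y = ≤-trans 0≤y (subst (_≤ x + y) (+-identityˡ y) (+-mono-≤ y 0≤x))

  *-monoˡ-≤-nonneg : ∀ {r x y} → 0r ≤ r → x ≤ y → r * x ≤ r * y
  *-monoˡ-≤-nonneg {r} {x} {y} 0≤r x≤y =
    0≤diff⇒≤ (subst (0r ≤_) r[y-x]≡ry-rx (*-nonneg 0≤r (≤⇒0≤diff x≤y)))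
    where
    r[y-x]≡ry-rx : r * (y + - x) ≡ r * y + - (r * x)
    r[y-x]≡ry-rx = begin
      r * (y + - x)       ≡⟨ distribˡ r y (- x) ⟩
      r * y + r * - x     ≡⟨ cong (r * y +_) (sym (-‿distribʳ-* r x)) ⟩
      r * y + - (r * x)   ∎

  square-nonneg : ∀ x → 0r ≤ x * x
  square-nonneg x with total 0r x
  ... | inj₁ 0≤x = *-nonneg 0≤x 0≤x
  ... | inj₂ x≤0 = subst (0r ≤_) -x*-x≡x*x (*-nonneg (≤0⇒0≤- x≤0) (≤0⇒0≤- x≤0))
    where
    -x*-x≡x*x : - x * - x ≡ x * x
    -x*-x≡x*x = begin
      - x * - x      ≡⟨ sym (-‿distribˡ-* x (- x)) ⟩
      - (x * - x)    ≡⟨ cong -_ (sym (-‿distribʳ-* x x)) ⟩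
      - - (x * x)    ≡⟨ -‿involutive (x * x) ⟩
      x * x          ∎

  0≤1 : 0r ≤ 1r
  0≤1 = subst (0r ≤_) (*-identityˡ 1r) (square-nonneg 1r)

  -- 1 + a is nonzero for a ≥ 0, since 0 < 1 ≤ 1 + a.
  1+nonneg≢0 : ∀ {a} → 0r ≤ a → ¬ (1r + a ≡ 0r)
  1+nonneg≢0 {a} 0≤a 1+a≡0 = 0≢1 (antisym 0≤1 1≤0)
    where
    1≤0 : 1r ≤ 0r
    1≤0 = subst₂ _≤_ (+-identityˡ 1r) (trans (+-comm a 1r) 1+a≡0) (+-mono-≤ 1r 0≤a)

  -- If y ≥ 0 and y·z = 1, then 0 ≤ x·y implies 0 ≤ x: the inverse
  -- z = y·(z·z) is nonnegative and x = (x·y)·z.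
  nonneg-cancelʳ : ∀ {x y z} → 0r ≤ y → y * z ≡ 1r → 0r ≤ x * y → 0r ≤ x
  nonneg-cancelʳ {x} {y} {z} 0≤y yz≡1 0≤xy = subst (0r ≤_) xy*z≡x (*-nonneg 0≤xy 0≤z)
    where
    0≤z : 0r ≤ z
    0≤z = subst (0r ≤_) y[zz]≡z (*-nonneg 0≤y (square-nonneg z))
      where
      y[zz]≡z : y * (z * z) ≡ z
      y[zz]≡z = begin
        y * (z * z)   ≡⟨ sym (*-assoc y z z) ⟩
        y * z * z     ≡⟨ cong (_* z) yz≡1 ⟩
        1r * z        ≡⟨ *-identityˡ z ⟩
        z             ∎
    xy*z≡x : x * y * z ≡ x
    xy*z≡x = begin
      x * y * z      ≡⟨ *-assoc x y z ⟩
      x * (y * z)    ≡⟨ cong (x *_) yz≡1 ⟩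
      x * 1r         ≡⟨ *-identityʳ x ⟩
      x              ∎

  min-of-≤ : ∀ {x y} → x ≤ y → min x y ≡ x
  min-of-≤ {x} {y} x≤y with total x y
  ... | inj₁ _   = refl
  ... | inj₂ y≤x = antisym y≤x x≤y

  min-of-≥ : ∀ {x y} → y ≤ x → min x y ≡ y
  min-of-≥ {x} {y} y≤x with total x y
  ... | inj₁ x≤y = antisym x≤y y≤x
  ... | inj₂ _   = refl

  ≤-totalPreorder : TotalPreorder 0ℓ 0ℓ 0ℓ
  ≤-totalPreorder = record { isTotalPreorder = IsTotalOrder.isTotalPreorder isTotalOrder }

  min-operator : MinOperator ≤-totalPreorder
  min-operator = record { _⊓_ = min ; x≤y⇒x⊓y≈x = min-of-≤ ; x≥y⇒x⊓y≈y = min-of-≥ }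

  open MinOp min-operator public
    using ()
    renaming (x⊓y≤y to min-≤ʳ; ⊓-comm to min-comm; ⊓-assoc to min-assoc; ⊓-idem to min-idem;
              ⊓-monoˡ-≤ to min-monoˡ-≤; mono-≤-distrib-⊓ to monotone-distrib-min)

  fromℚ-0 : fromℚ 0ℚ ≡ 0r
  fromℚ-0 = +-identityˡ-unique (fromℚ 0ℚ) (fromℚ 0ℚ) (sym (fromℚ-+ 0ℚ 0ℚ))

  fromℚ-neg-1 : fromℚ (ℚ.- 1ℚ) ≡ - 1r
  fromℚ-neg-1 = +-inverseˡ-unique (fromℚ (ℚ.- 1ℚ)) 1r (begin
    fromℚ (ℚ.- 1ℚ) + 1r         ≡⟨ cong (fromℚ (ℚ.- 1ℚ) +_) (sym fromℚ-1) ⟩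
    fromℚ (ℚ.- 1ℚ) + fromℚ 1ℚ   ≡⟨ sym (fromℚ-+ (ℚ.- 1ℚ) 1ℚ) ⟩
    fromℚ 0ℚ                    ≡⟨ fromℚ-0 ⟩
    0r                          ∎)

  fromℚ-numeral-suc : ∀ k → fromℚ (numeral (suc k)) ≡ 1r + fromℚ (numeral k)
  fromℚ-numeral-suc k = trans (fromℚ-+ 1ℚ (numeral k)) (cong (_+ fromℚ (numeral k)) fromℚ-1)

  fromℚ-numeral-nonneg : ∀ k → 0r ≤ fromℚ (numeral k)
  fromℚ-numeral-nonneg zero    = ≤-reflexive (sym fromℚ-0)
  fromℚ-numeral-nonneg (suc k) =
    subst (0r ≤_) (sym (fromℚ-numeral-suc k)) (+-nonneg 0≤1 (fromℚ-numeral-nonneg k))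

  -- fromℚ preserves nonnegativity: fromℚ (n/(d+1)) · fromℚ (d+1) = fromℚ n ≥ 0
  -- and fromℚ (d+1) = 1 + fromℚ d is nonnegative and invertible.
  fromℚ-nonneg : ∀ r → 0ℚ ℚ.≤ r → 0r ≤ fromℚ r
  fromℚ-nonneg (mkℚ -[1+ _ ] _ _) (ℚ.*≤* ())
  fromℚ-nonneg r@(mkℚ (ℤ.+ n) d c) _ =
    nonneg-cancelʳ (fromℚ-numeral-nonneg (suc d)) (proj₂ (inverse den den≢0)) 0≤r*den
    where
    den : ℝ
    den = fromℚ (numeral (suc d))
    den≢0 : ¬ (den ≡ 0r)
    den≢0 den≡0 = 1+nonneg≢0 (fromℚ-numeral-nonneg d) (trans (sym (fromℚ-numeral-suc d)) den≡0)
    0≤r*den : 0r ≤ fromℚ r * den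
    0≤r*den = subst (0r ≤_) (trans (cong fromℚ (sym (clear-denominator n d c)))
                                   (fromℚ-* r (numeral (suc d))))
                    (fromℚ-numeral-nonneg n)

module Soundness (R : RealNumbers) where
  open RealNumbers R
  open IsCommutativeRing isCommutativeRing
    using (+-assoc; +-comm; +-identityʳ; *-assoc; *-identityˡ; *-identityʳ;
           distribˡ; distribʳ; zeroˡ)
  open IsTotalOrder isTotalOrder using () renaming (trans to ≤-trans; reflexive to ≤-reflexive)
  open OrderedField R

  ⟦_⟧ᴿ : ∀ {L c} → Formula L c → (L → ℝ) → ℝ
  ⟦ φ ⟧ᴿ = ⟦_⟧ R φ

  axEq-valid : ∀ {L c} {φ ψ : Formula L c} (M : L → ℝ) → AxEq φ ψ → ⟦ φ ⟧ᴿ M ≡ ⟦ ψ ⟧ᴿ M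
  axEq-valid M (⊕-comm φ ψ)    = +-comm _ _
  axEq-valid M (⊕-assoc φ ψ ξ) = trans (cong (_+ ⟦ ξ ⟧ᴿ M) (+-comm _ _)) (+-assoc _ _ _)
  axEq-valid M (⊕-id φ)        = +-identityʳ _
  axEq-valid M (one-· φ)       = trans (cong (_* ⟦ φ ⟧ᴿ M) fromℚ-1) (*-identityˡ _)
  axEq-valid M (·-distˡ r s φ) = begin
    fromℚ r * x + fromℚ s * x   ≡⟨ +-comm _ _ ⟩
    fromℚ s * x + fromℚ r * x   ≡⟨ sym (distribʳ x (fromℚ s) (fromℚ r)) ⟩
    (fromℚ s + fromℚ r) * x     ≡⟨ cong (_* x) (sym (fromℚ-+ s r)) ⟩
    fromℚ (s ℚ.+ r) * x         ∎
    where
    open ≡-Reasoning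
    x : ℝ
    x = ⟦ φ ⟧ᴿ M
  axEq-valid M (·-distʳ r φ ψ) = sym (distribˡ _ _ _)
  axEq-valid M (·-assoc r s φ) = trans (sym (*-assoc _ _ _)) (cong (_* ⟦ φ ⟧ᴿ M) (sym (fromℚ-* r s)))
  axEq-valid M (⊓-idem φ)      = min-idem _
  axEq-valid M (⊓-comm φ ψ)    = min-comm _ _
  axEq-valid M (⊓-assoc φ ψ ξ) = min-assoc _ _ _
  axEq-valid M (⊓-⊕ φ ψ ξ)     =
    sym (monotone-distrib-min (cong (_+ ⟦ ξ ⟧ᴿ M)) (+-mono-≤ (⟦ ξ ⟧ᴿ M)) _ _)
  axEq-valid M (·-⊓ r φ ψ 0≤r) =
    monotone-distrib-min (cong (fromℚ r *_)) (*-monoˡ-≤-nonneg (fromℚ-nonneg r 0≤r)) _ _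

  axiom-valid : ∀ {L c} {i : Ineq L c} (M : L → ℝ) → Admissible R L c M → Axiom i → Holds R M i
  axiom-valid M adm (eqˡ e)      = ≤-reflexive (axEq-valid M e)
  axiom-valid M adm (eqʳ e)      = ≤-reflexive (sym (axEq-valid M e))
  axiom-valid M adm (zero-· φ)   = ≤-reflexive (trans (cong (_* ⟦ φ ⟧ᴿ M) fromℚ-0) (zeroˡ _))
  axiom-valid M adm (⊓-≤ φ ψ)    = min-≤ʳ _ _
  axiom-valid M adm (bound₁ P)   =
    subst (_≤ M P) (sym (trans (*-identityʳ _) fromℚ-neg-1)) (proj₁ (adm P))
  axiom-valid M adm (bound₂ P)   = proj₂ (adm P)

  sound : ∀ {L c} {T : Theory L c} (M : L → ℝ) → Admissible R L c M →
          (∀ j → T j → Holds R M j) → ∀ {i} → T ⊢ i → Holds R M i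
  sound M adm M⊨T (hyp {i} i∈T)     = M⊨T i i∈T
  sound M adm M⊨T (ax a)            = axiom-valid M adm a
  sound M adm M⊨T (r1 d e)          = ≤-trans (sound M adm M⊨T d) (sound M adm M⊨T e)
  sound M adm M⊨T (r2 r ξ 0≤r d)    =
    +-mono-≤ _ (*-monoˡ-≤-nonneg (fromℚ-nonneg r 0≤r) (sound M adm M⊨T d))
  sound M adm M⊨T (r3 d)            = min-monoˡ-≤ 0r (sound M adm M⊨T d)

mainTheorem5 : (L : Set) (c : Case) (T : Theory L c) (φ : Formula L c) →
               T ⊢ 𝟘 ≼ φ → T ⊨ 𝟘 ≼ φ
mainTheorem5 L c T φ ⊢0≤φ R (M , adm) M⊨T = Soundness.sound R M adm M⊨T ⊢0≤φ
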